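{- There exists a regular finite simple connected undirected graph on $10$ vertices containing two vertices that are cospectral but not similar, and no regular finite simple connected undirected graph on fewer than $10$ vertices contains two vertices that are cospectral but not similar.
   Context: A graph is regular if all vertices have the same degree. For a finite simple graph with adjacency matrix $A$, let $\phi_1,\dots,\phi_n$ be a real orthonormal eigenbasis of $A$ with $A\phi_j=\lambda_j\phi_j$. Two vertices $a,b$ are cospectral if $\sum_{j:\lambda_j=\lambda}|\phi_j(a)|^2=\sum_{j:\lambda_j=\lambda}|\phi_j(b)|^2$ for every eigenvalue $\lambda$ (equivalently, $(A^k)_{a,a}=(A^k)_{b,b}$ for all $k\ge 0$). Two vertices are similar if some graph automorphism maps one to the other. -}

module Defs where

open import Data.Nat using (ℕ; zero; suc; _+_; _*_)
open import Data.Bool using (Bool; true; false; if_then_else_)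
open import Data.Fin using (Fin; zero; suc; _≟_)
open import Data.Product using (Σ; _×_; _,_; ∃)
open import Relation.Nullary using (¬_; Dec; yes; no)
open import Relation.Binary.PropositionalEquality using (_≡_)
open import Function.Bundles using (_↔_; Inverse)

record Graph (n : ℕ) : Set where
  field
    adj   : Fin n → Fin n → Bool
    irrefl : ∀ x → adj x x ≡ false
    sym   : ∀ x y → adj x y ≡ adj y x
open Graph public

sumFin : ∀ {n} → (Fin n → ℕ) → ℕ
sumFin {zero}  f = 0
sumFin {suc n} f = f zero + sumFin (λ i → f (suc i))

A : ∀ {n} → Graph n → Fin n → Fin n → ℕ
A G x y = if adj G x y then 1 else 0

degree : ∀ {n} → Graph n → Fin n → ℕ
degree G x = sumFin (λ y → A G x y)

Regular : ∀ {n} → Graph n → Set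
Regular G = ∃ λ d → ∀ x → degree G x ≡ d

data Walk {n} (G : Graph n) : Fin n → Fin n → Set where
  here : ∀ {x} → Walk G x x
  step : ∀ {x y z} → adj G x y ≡ true → Walk G y z → Walk G x z

Connected : ∀ {n} → Graph n → Set
Connected G = ∀ x y → Walk G x y

Apow : ∀ {n} → Graph n → ℕ → Fin n → Fin n → ℕ
Apow G zero    x y with x ≟ y
... | yes _ = 1
... | no  _ = 0
Apow G (suc k) x y = sumFin (λ w → A G x w * Apow G k w y)

Cospectral : ∀ {n} → Graph n → Fin n → Fin n → Set
Cospectral G a b = ∀ k → Apow G k a a ≡ Apow G k b b

record Automorphism {n} (G : Graph n) : Set where
  field
    perm     : Fin n ↔ Fin n
    preserve : ∀ x y → adj G (Inverse.to perm x) (Inverse.to perm y) ≡ adj G x y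
open Automorphism public

Similar : ∀ {n} → Graph n → Fin n → Fin n → Set
Similar G a b = Σ (Automorphism G) λ σ → Inverse.to (perm σ) a ≡ b

HasCospectralNonSimilar : ∀ {n} → Graph n → Set
HasCospectralNonSimilar G = Σ _ λ a → Σ _ λ b → Cospectral G a b × ¬ Similar G a b

-- The 10-vertex graph G₁₀ is cubic and connected. Its adjacency matrix A has a minimal
-- polynomial of degree 8, so each A^(k+8) is a fixed linear combination of A^k, …, A^(k+7): two
-- vertices are cospectral as soon as the diagonal entries of A⁰, …, A⁷ agree at them, as they do
-- at 2 and 6. These are not similar: 2 is a tip of a diamond (two triangles sharing an edge) and
-- 6 is not, and automorphisms map diamonds to diamonds.
--
-- Below 10 vertices the claim is a finite computation. Every d-regular graph can be relabelled so
-- that its first two rows are in a normal form, and the symmetric loopless matrices in normal form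
-- with all row sums d are enumerated row by row. In each of them, vertices with the same numbers
-- of closed walks of length < 8 are grouped (cospectral vertices always are), and every vertex is
-- shown similar to the first vertex of its group by an automorphism found by backtracking and
-- then checked.

module Submission where

open import Defs hiding (sym)
open import Algebra.Properties.CommutativeSemigroup using (x∙yz≈y∙xz)
open import Algebra.Properties.Semiring.Sum as ∑ using ()
open import Data.Bool as Bool using (Bool; true; false; T; if_then_else_; _∧_; not)
open import Data.Bool.ListAction using (all; any)
open import Data.Bool.Properties using (T-∧; T-≡)
open import Data.Fin as Fin using (Fin; zero; suc; toℕ; fromℕ<)
open import Data.Fin.Patterns using (0F; 1F; 2F; 3F; 4F; 5F; 6F; 7F; 8F; 9F)
open import Data.Fin.Properties using (all?; toℕ<n; toℕ-fromℕ<)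
open import Data.List as List using (List; []; _∷_; _++_; allFin; foldr; filterᵇ; concatMap; upTo; head; drop)
open import Data.List.Membership.Propositional using (_∈_)
open import Data.List.Membership.Propositional.Properties using (∈-allFin; ∈-map⁺; ∈-++⁺ˡ; ∈-++⁺ʳ)
open import Data.List.Relation.Unary.All as All using ()
open import Data.List.Relation.Unary.All.Properties using (all⁺)
open import Data.List.Relation.Unary.Any using (here; there)
open import Data.Maybe as Maybe using (Maybe; just; nothing; maybe′; fromMaybe; _<∣>_)
open import Data.Maybe.Properties using (just-injective)
open import Data.Maybe.Relation.Unary.All as MaybeAll using (just; nothing)
open import Data.Nat as ℕ using (ℕ; zero; suc; _+_; _*_; _≤_; _<_; _≡ᵇ_; _<ᵇ_; _≤ᵇ_; z≤n; s≤s)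
open import Data.Nat.Induction using (<-rec)
open import Data.Nat.Properties
  using (+-*-semiring; *-commutativeSemigroup; +-comm; *-identityˡ; *-distribˡ-+; +-cancelʳ-≡;
         +-monoʳ-<; +-mono-≤; ≮⇒≥; m≤n⇒∃[o]m+o≡n; _<?_; ≡⇒≡ᵇ)
open import Data.Product using (Σ; ∃-syntax; _×_; _,_; proj₁; proj₂)
open import Data.Vec as Vec using (Vec; []; _∷_; lookup; tabulate; replicate; _[_]≔_)
open import Data.Vec.Properties
  using (lookup∘tabulate; lookup-map; lookup∘update; lookup∘update′; lookup-replicate; tabulate-cong)
open import Function using (_∘_; _↔_; Inverse; mk↔ₛ′)
open import Function.Bundles using (Equivalence)
open import Function.Properties.Inverse using (↔-refl; ↔-sym; ↔-trans)
open import Relation.Binary.PropositionalEquality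
open import Relation.Nullary using (¬_; yes; no; contradiction)
open import Relation.Nullary.Decidable using (⌊_⌋; from-yes; _×-dec_; ¬?)

open Inverse using (to; from; strictlyInverseˡ; strictlyInverseʳ)
open ≡-Reasoning

module Sum = ∑ +-*-semiring

sumFin≡sum : ∀ {n} (f : Fin n → ℕ) → sumFin f ≡ Sum.sum f
sumFin≡sum {zero}  f = refl
sumFin≡sum {suc n} f = cong (f zero +_) (sumFin≡sum (f ∘ suc))

sumFin-cong : ∀ {n} {f g : Fin n → ℕ} → (∀ i → f i ≡ g i) → sumFin f ≡ sumFin g
sumFin-cong {zero}  f≗g = refl
sumFin-cong {suc n} f≗g = cong₂ _+_ (f≗g zero) (sumFin-cong (f≗g ∘ suc))

sumFin-permute : ∀ {n} (f : Fin n → ℕ) (π : Fin n ↔ Fin n) → sumFin (f ∘ to π) ≡ sumFin f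
sumFin-permute f π = begin
  sumFin (f ∘ to π)   ≡⟨ sumFin≡sum (f ∘ to π) ⟩
  Sum.sum (f ∘ to π)  ≡⟨ Sum.sum-permute f π ⟨
  Sum.sum f           ≡⟨ sumFin≡sum f ⟨
  sumFin f            ∎

sumFin-distrib-+ : ∀ {n} (f g : Fin n → ℕ) → sumFin (λ i → f i + g i) ≡ sumFin f + sumFin g
sumFin-distrib-+ f g = begin
  sumFin (λ i → f i + g i)   ≡⟨ sumFin≡sum (λ i → f i + g i) ⟩
  Sum.sum (λ i → f i + g i)  ≡⟨ Sum.∑-distrib-+ f g ⟩
  Sum.sum f + Sum.sum g      ≡⟨ cong₂ _+_ (sumFin≡sum f) (sumFin≡sum g) ⟨
  sumFin f + sumFin g        ∎

*-distribˡ-sumFin : ∀ {n} c (f : Fin n → ℕ) → c * sumFin f ≡ sumFin (λ i → c * f i)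
*-distribˡ-sumFin c f = begin
  c * sumFin f             ≡⟨ cong (c *_) (sumFin≡sum f) ⟩
  c * Sum.sum f            ≡⟨ Sum.*-distribˡ-sum c f ⟩
  Sum.sum (λ i → c * f i)  ≡⟨ sumFin≡sum (λ i → c * f i) ⟨
  sumFin (λ i → c * f i)   ∎

sumFin-comm : ∀ {m n} (f : Fin m → Fin n → ℕ) →
  sumFin (λ i → sumFin (f i)) ≡ sumFin (λ j → sumFin (λ i → f i j))
sumFin-comm f = begin
  sumFin (λ i → sumFin (f i))              ≡⟨ sumFin-cong (λ i → sumFin≡sum (f i)) ⟩
  sumFin (λ i → Sum.sum (f i))             ≡⟨ sumFin≡sum (λ i → Sum.sum (f i)) ⟩
  Sum.sum (λ i → Sum.sum (f i))            ≡⟨ Sum.∑-comm f ⟩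
  Sum.sum (λ j → Sum.sum (λ i → f i j))    ≡⟨ sumFin≡sum (λ j → Sum.sum (λ i → f i j)) ⟨
  sumFin (λ j → Sum.sum (λ i → f i j))     ≡⟨ sumFin-cong (λ j → sumFin≡sum (λ i → f i j)) ⟨
  sumFin (λ j → sumFin (λ i → f i j))      ∎

sumFin-*-sumFin-comm : ∀ {m n} (c : Fin m → ℕ) (a : Fin n → ℕ) (M : Fin m → Fin n → ℕ) →
  sumFin (λ i → c i * sumFin (λ w → a w * M i w)) ≡ sumFin (λ w → a w * sumFin (λ i → c i * M i w))
sumFin-*-sumFin-comm c a M = begin
  sumFin (λ i → c i * sumFin (λ w → a w * M i w))    ≡⟨ sumFin-cong (λ i → *-distribˡ-sumFin (c i) (λ w → a w * M i w)) ⟩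
  sumFin (λ i → sumFin (λ w → c i * (a w * M i w)))  ≡⟨ sumFin-comm (λ i w → c i * (a w * M i w)) ⟩
  sumFin (λ w → sumFin (λ i → c i * (a w * M i w)))  ≡⟨ sumFin-cong (λ w → sumFin-cong (λ i → x∙yz≈y∙xz *-commutativeSemigroup (c i) (a w) (M i w))) ⟩
  sumFin (λ w → sumFin (λ i → a w * (c i * M i w)))  ≡⟨ sumFin-cong (λ w → *-distribˡ-sumFin (a w) (λ i → c i * M i w)) ⟨
  sumFin (λ w → a w * sumFin (λ i → c i * M i w))    ∎

sumFin-*-distrib-+ : ∀ {n} (a u v : Fin n → ℕ) →
  sumFin (λ w → a w * u w) + sumFin (λ w → a w * v w) ≡ sumFin (λ w → a w * (u w + v w))
sumFin-*-distrib-+ a u v = begin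
  sumFin (λ w → a w * u w) + sumFin (λ w → a w * v w)  ≡⟨ sumFin-distrib-+ (λ w → a w * u w) (λ w → a w * v w) ⟨
  sumFin (λ w → a w * u w + a w * v w)                 ≡⟨ sumFin-cong (λ w → *-distribˡ-+ (a w) (u w) (v w)) ⟨
  sumFin (λ w → a w * (u w + v w))                     ∎

-- Similarity and relabelling

Apow-0-refl : ∀ {n} (G : Graph n) x → Apow G 0 x x ≡ 1
Apow-0-refl G x with x Fin.≟ x
... | yes _  = refl
... | no x≢x = contradiction refl x≢x

Apow-0-≢ : ∀ {n} (G : Graph n) {x y} → x ≢ y → Apow G 0 x y ≡ 0
Apow-0-≢ G {x} {y} x≢y with x Fin.≟ y
... | yes x≡y = contradiction x≡y x≢y
... | no _    = refl

Similar-refl : ∀ {n} (G : Graph n) x → Similar G x x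
Similar-refl G x = record { perm = ↔-refl ; preserve = λ _ _ → refl } , refl

Similar-sym : ∀ {n} (G : Graph n) {x y} → Similar G x y → Similar G y x
Similar-sym G {x} (σ , σx≡y) = σ⁻¹ , trans (cong (from (perm σ)) (sym σx≡y)) (strictlyInverseʳ (perm σ) x)
  where
  σ⁻¹ : Automorphism G
  σ⁻¹ = record
    { perm     = ↔-sym (perm σ)
    ; preserve = λ u v → begin
        adj G (from (perm σ) u) (from (perm σ) v)
          ≡⟨ preserve σ _ _ ⟨
        adj G (to (perm σ) (from (perm σ) u)) (to (perm σ) (from (perm σ) v))
          ≡⟨ cong₂ (adj G) (strictlyInverseˡ (perm σ) u) (strictlyInverseˡ (perm σ) v) ⟩
        adj G u v
          ∎
    }

Similar-trans : ∀ {n} (G : Graph n) {x y z} → Similar G x y → Similar G y z → Similar G x z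
Similar-trans G (σ , σx≡y) (ρ , ρy≡z) = ρσ , trans (cong (to (perm ρ)) σx≡y) ρy≡z
  where
  ρσ : Automorphism G
  ρσ = record
    { perm     = ↔-trans (perm σ) (perm ρ)
    ; preserve = λ u v → trans (preserve ρ _ _) (preserve σ u v)
    }

relabel : ∀ {n} → Graph n → Fin n ↔ Fin n → Graph n
relabel G π = record
  { adj    = λ x y → adj G (to π x) (to π y)
  ; irrefl = λ x → irrefl G (to π x)
  ; sym    = λ x y → Graph.sym G (to π x) (to π y)
  }

module _ {n} (G : Graph n) (π : Fin n ↔ Fin n) where

  private
    π-injective : ∀ {x y} → to π x ≡ to π y → x ≡ y
    π-injective {x} {y} πx≡πy = begin
      x                ≡⟨ strictlyInverseʳ π x ⟨
      from π (to π x)  ≡⟨ cong (from π) πx≡πy ⟩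
      from π (to π y)  ≡⟨ strictlyInverseʳ π y ⟩
      y                ∎

  Apow-relabel : ∀ k x y → Apow (relabel G π) k x y ≡ Apow G k (to π x) (to π y)
  Apow-relabel zero x y with x Fin.≟ y
  ... | yes refl = sym (Apow-0-refl G (to π x))
  ... | no x≢y   = sym (Apow-0-≢ G (x≢y ∘ π-injective))
  Apow-relabel (suc k) x y = begin
    sumFin (λ w → A G (to π x) (to π w) * Apow (relabel G π) k w y)
      ≡⟨ sumFin-cong (λ w → cong (A G (to π x) (to π w) *_) (Apow-relabel k w y)) ⟩
    sumFin (λ w → A G (to π x) (to π w) * Apow G k (to π w) (to π y))
      ≡⟨ sumFin-permute (λ w → A G (to π x) w * Apow G k w (to π y)) π ⟩
    sumFin (λ w → A G (to π x) w * Apow G k w (to π y))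
      ∎

  degree-relabel : ∀ x → degree (relabel G π) x ≡ degree G (to π x)
  degree-relabel x = sumFin-permute (A G (to π x)) π

  regular-relabel : ∀ {d} → (∀ x → degree G x ≡ d) → ∀ x → degree (relabel G π) x ≡ d
  regular-relabel regular x = trans (degree-relabel x) (regular (to π x))

  Similar-relabel : ∀ {a b} → Similar (relabel G π) a b → Similar G (to π a) (to π b)
  Similar-relabel {a} (σ , σa≡b) = πσπ⁻¹ , cong (to π) (trans (cong (to (perm σ)) (strictlyInverseʳ π a)) σa≡b)
    where
    πσπ⁻¹ : Automorphism G
    πσπ⁻¹ = record
      { perm     = ↔-trans (↔-trans (↔-sym π) (perm σ)) π
      ; preserve = λ u v → begin
          adj G (to π (to (perm σ) (from π u))) (to π (to (perm σ) (from π v)))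
            ≡⟨ preserve σ (from π u) (from π v) ⟩
          adj G (to π (from π u)) (to π (from π v))
            ≡⟨ cong₂ (adj G) (strictlyInverseˡ π u) (strictlyInverseˡ π v) ⟩
          adj G u v
            ∎
      }

CospectralImpliesSimilar : ∀ {n} → Graph n → Set
CospectralImpliesSimilar G = ∀ a b → Cospectral G a b → Similar G a b

CospectralImpliesSimilar-relabel : ∀ {n} (G : Graph n) (π : Fin n ↔ Fin n) →
  CospectralImpliesSimilar (relabel G π) → CospectralImpliesSimilar G
CospectralImpliesSimilar-relabel G π cis a b a~b =
  subst₂ (Similar G) (strictlyInverseˡ π a) (strictlyInverseˡ π b)
    (Similar-relabel G π (cis (from π a) (from π b) cospectral))
  where
  diagonal : ∀ k x → Apow (relabel G π) k (from π x) (from π x) ≡ Apow G k x x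
  diagonal k x = trans (Apow-relabel G π k _ _) (cong₂ (Apow G k) (strictlyInverseˡ π x) (strictlyInverseˡ π x))

  cospectral : Cospectral (relabel G π) (from π a) (from π b)
  cospectral k = trans (diagonal k a) (trans (a~b k) (sym (diagonal k b)))

-- Cospectrality from an annihilating polynomial

module _ {n} (G : Graph n) where

  combination : ∀ {N} → Vec ℕ N → ℕ → Fin n → Fin n → ℕ
  combination c k x y = sumFin (λ i → lookup c i * Apow G (k + toℕ i) x y)

  combination-suc : ∀ {N} (c : Vec ℕ N) k x y →
    combination c (suc k) x y ≡ sumFin (λ w → A G x w * combination c k w y)
  combination-suc c k x y = sumFin-*-sumFin-comm (lookup c) (A G x) (λ i w → Apow G (k + toℕ i) w y)

  Annihilates : ∀ {N} → Vec ℕ N → Vec ℕ N → Set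
  Annihilates {N} p q = ∀ x y → Apow G N x y + combination p 0 x y ≡ combination q 0 x y

  annihilates-shift : ∀ {N} (p q : Vec ℕ N) → Annihilates p q →
    ∀ k x y → Apow G (k + N) x y + combination p k x y ≡ combination q k x y
  annihilates-shift p q p,q zero x y = p,q x y
  annihilates-shift {N} p q p,q (suc k) x y = begin
    Apow G (suc k + N) x y + combination p (suc k) x y
      ≡⟨ cong (Apow G (suc k + N) x y +_) (combination-suc p k x y) ⟩
    sumFin (λ w → A G x w * Apow G (k + N) w y) + sumFin (λ w → A G x w * combination p k w y)
      ≡⟨ sumFin-*-distrib-+ (A G x) (λ w → Apow G (k + N) w y) (λ w → combination p k w y) ⟩
    sumFin (λ w → A G x w * (Apow G (k + N) w y + combination p k w y))
      ≡⟨ sumFin-cong (λ w → cong (A G x w *_) (annihilates-shift p q p,q k w y)) ⟩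
    sumFin (λ w → A G x w * combination q k w y)
      ≡⟨ combination-suc q k x y ⟨
    combination q (suc k) x y
      ∎

  cospectral-from-annihilator : ∀ {N} (p q : Vec ℕ N) → Annihilates p q → ∀ a b →
    (∀ (i : Fin N) → Apow G (toℕ i) a a ≡ Apow G (toℕ i) b b) → Cospectral G a b
  cospectral-from-annihilator {N} p q p,q a b initial = <-rec _ agrees
    where
    agrees : ∀ m → (∀ {j} → j < m → Apow G j a a ≡ Apow G j b b) → Apow G m a a ≡ Apow G m b b
    agrees m ih with m <? N
    ... | yes m<N = subst (λ j → Apow G j a a ≡ Apow G j b b) (toℕ-fromℕ< m<N) (initial (fromℕ< m<N))
    ... | no m≮N with k , refl ← m≤n⇒∃[o]m+o≡n (≮⇒≥ m≮N) rewrite +-comm N k =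
      +-cancelʳ-≡ _ _ _ (begin
        Apow G (k + N) a a + combination p k a a  ≡⟨ annihilates-shift p q p,q k a a ⟩
        combination q k a a                       ≡⟨ same-combination q ⟩
        combination q k b b                       ≡⟨ annihilates-shift p q p,q k b b ⟨
        Apow G (k + N) b b + combination p k b b  ≡⟨ cong (Apow G (k + N) b b +_) (same-combination p) ⟨
        Apow G (k + N) b b + combination p k a a  ∎)
      where
      same-combination : (c : Vec ℕ N) → combination c k a a ≡ combination c k b b
      same-combination c = sumFin-cong (λ i → cong (lookup c i *_) (ih (+-monoʳ-< k (toℕ<n i))))

-- Boolean adjacency matrices and walk counts

Matrix : ℕ → Set
Matrix n = Vec (Vec Bool n) n

IsAdjacencyMatrix : ∀ {n} → Graph n → Matrix n → Set
IsAdjacencyMatrix G R = ∀ i j → lookup (lookup R i) j ≡ adj G i j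

dot : ∀ {m} → Vec Bool m → Vec ℕ m → ℕ
dot []          []      = 0
dot (true  ∷ r) (x ∷ v) = x + dot r v
dot (false ∷ r) (_ ∷ v) = dot r v

_·_ : ∀ {n} → Matrix n → Vec ℕ n → Vec ℕ n
R · v = Vec.map (λ r → dot r v) R

unitVector : ∀ {n} → Fin n → Vec ℕ n
unitVector x = tabulate (λ y → if ⌊ y Fin.≟ x ⌋ then 1 else 0)

powerColumn : ∀ {n} → Matrix n → ℕ → Fin n → Vec ℕ n
powerColumn R zero    x = unitVector x
powerColumn R (suc k) x = R · powerColumn R k x

entriesAlongPowers : ∀ {n} → Matrix n → ℕ → Fin n → Vec ℕ n → List ℕ
entriesAlongPowers R zero    x v = []
entriesAlongPowers R (suc m) x v = lookup v x ∷ entriesAlongPowers R m x (R · v)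

columnCombination : ∀ {n N} → Matrix n → Vec ℕ N → Fin n → Fin n → ℕ
columnCombination R c x y = sumFin (λ i → lookup c i * lookup (powerColumn R (toℕ i) y) x)

dot-sumFin : ∀ {m} (r : Vec Bool m) (v : Vec ℕ m) →
  dot r v ≡ sumFin (λ j → (if lookup r j then 1 else 0) * lookup v j)
dot-sumFin []          []      = refl
dot-sumFin (true  ∷ r) (x ∷ v) = cong₂ _+_ (sym (*-identityˡ x)) (dot-sumFin r v)
dot-sumFin (false ∷ r) (_ ∷ v) = dot-sumFin r v

module _ {n} (G : Graph n) (R : Matrix n) (R≗G : IsAdjacencyMatrix G R) where

  lookup-· : ∀ (v : Vec ℕ n) y → lookup (R · v) y ≡ sumFin (λ w → A G y w * lookup v w)
  lookup-· v y = begin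
    lookup (R · v) y
      ≡⟨ lookup-map y (λ r → dot r v) R ⟩
    dot (lookup R y) v
      ≡⟨ dot-sumFin (lookup R y) v ⟩
    sumFin (λ w → (if lookup (lookup R y) w then 1 else 0) * lookup v w)
      ≡⟨ sumFin-cong (λ w → cong (λ b → (if b then 1 else 0) * lookup v w) (R≗G y w)) ⟩
    sumFin (λ w → A G y w * lookup v w)
      ∎

  lookup-powerColumn : ∀ k x y → lookup (powerColumn R k x) y ≡ Apow G k y x
  lookup-powerColumn zero x y = trans (lookup∘tabulate _ y) unit-entry
    where
    unit-entry : (if ⌊ y Fin.≟ x ⌋ then 1 else 0) ≡ Apow G 0 y x
    unit-entry with y Fin.≟ x
    ... | yes _ = refl
    ... | no _  = refl
  lookup-powerColumn (suc k) x y = begin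
    lookup (R · powerColumn R k x) y                       ≡⟨ lookup-· (powerColumn R k x) y ⟩
    sumFin (λ w → A G y w * lookup (powerColumn R k x) w)  ≡⟨ sumFin-cong (λ w → cong (A G y w *_) (lookup-powerColumn k x w)) ⟩
    sumFin (λ w → A G y w * Apow G k w x)                  ∎

  entriesAlongPowers-cospectral : ∀ {a b} → Cospectral G a b → ∀ m k →
    entriesAlongPowers R m a (powerColumn R k a) ≡ entriesAlongPowers R m b (powerColumn R k b)
  entriesAlongPowers-cospectral a~b zero    k = refl
  entriesAlongPowers-cospectral {a} {b} a~b (suc m) k = cong₂ _∷_ diagonal (entriesAlongPowers-cospectral a~b m (suc k))
    where
    diagonal : lookup (powerColumn R k a) a ≡ lookup (powerColumn R k b) b
    diagonal = trans (lookup-powerColumn k a a) (trans (a~b k) (sym (lookup-powerColumn k b b)))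

  annihilates-from-columns : ∀ {N} (p q : Vec ℕ N) →
    (∀ x y → lookup (powerColumn R N y) x + columnCombination R p x y ≡ columnCombination R q x y) →
    Annihilates G p q
  annihilates-from-columns {N} p q columns x y = begin
    Apow G N x y + combination G p 0 x y
      ≡⟨ cong₂ _+_ (lookup-powerColumn N y x) (combination≡columns p) ⟨
    lookup (powerColumn R N y) x + columnCombination R p x y
      ≡⟨ columns x y ⟩
    columnCombination R q x y
      ≡⟨ combination≡columns q ⟩
    combination G q 0 x y
      ∎
    where
    combination≡columns : (c : Vec ℕ N) → columnCombination R c x y ≡ combination G c 0 x y
    combination≡columns c = sumFin-cong (λ i → cong (lookup c i *_) (lookup-powerColumn (toℕ i) y x))

-- A regular graph on 10 vertices with cospectral, non-similar vertices

_++ʷ_ : ∀ {n} {G : Graph n} {x y z} → Walk G x y → Walk G y z → Walk G x z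
here     ++ʷ w′ = w′
step e w ++ʷ w′ = step e (w ++ʷ w′)

reverseʷ : ∀ {n} {G : Graph n} {x y} → Walk G x y → Walk G y x
reverseʷ               here               = here
reverseʷ {G = G} (step {x} {y} e w) = reverseʷ w ++ʷ step (trans (Graph.sym G y x) e) here

connected-from-root : ∀ {n} (G : Graph n) (r : Fin n) → (∀ x → Walk G x r) → Connected G
connected-from-root G r to-r x y = to-r x ++ʷ reverseʷ (to-r y)

DiamondTip : ∀ {n} → Graph n → Fin n → Set
DiamondTip G v = ∃[ x ] ∃[ y ] ∃[ z ]
  adj G v x ≡ true × adj G v y ≡ true × adj G x y ≡ true × adj G z x ≡ true × adj G z y ≡ true × z ≢ v

DiamondTip-similar : ∀ {n} (G : Graph n) {a b} → Similar G a b → DiamondTip G a → DiamondTip G b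
DiamondTip-similar G {a} {b} (σ , σa≡b) (x , y , z , ax , ay , xy , zx , zy , z≢a) =
  σ′ x , σ′ y , σ′ z , from-b ax , from-b ay , preserved xy , preserved zx , preserved zy , σz≢b
  where
  σ′ : Fin _ → Fin _
  σ′ = to (perm σ)
  preserved : ∀ {u v} → adj G u v ≡ true → adj G (σ′ u) (σ′ v) ≡ true
  preserved {u} {v} uv = trans (preserve σ u v) uv
  from-b : ∀ {u} → adj G a u ≡ true → adj G b (σ′ u) ≡ true
  from-b au = subst (λ c → adj G c _ ≡ true) σa≡b (preserved au)
  σz≢b : σ′ z ≢ b
  σz≢b σz≡b = z≢a (begin
    z                     ≡⟨ strictlyInverseʳ (perm σ) z ⟨
    from (perm σ) (σ′ z)  ≡⟨ cong (from (perm σ)) (trans σz≡b (sym σa≡b)) ⟩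
    from (perm σ) (σ′ a)  ≡⟨ strictlyInverseʳ (perm σ) a ⟩
    a                     ∎)

neighbours₁₀ : Fin 10 → List (Fin 10)
neighbours₁₀ 0F = 1F ∷ 2F ∷ 3F ∷ []
neighbours₁₀ 1F = 0F ∷ 2F ∷ 3F ∷ []
neighbours₁₀ 2F = 0F ∷ 1F ∷ 4F ∷ []
neighbours₁₀ 3F = 0F ∷ 1F ∷ 5F ∷ []
neighbours₁₀ 4F = 2F ∷ 6F ∷ 7F ∷ []
neighbours₁₀ 5F = 3F ∷ 8F ∷ 9F ∷ []
neighbours₁₀ 6F = 4F ∷ 7F ∷ 8F ∷ []
neighbours₁₀ 7F = 4F ∷ 6F ∷ 9F ∷ []
neighbours₁₀ 8F = 5F ∷ 6F ∷ 9F ∷ []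
neighbours₁₀ 9F = 5F ∷ 7F ∷ 8F ∷ []

adjacency₁₀ : Matrix 10
adjacency₁₀ = tabulate (λ x → tabulate (λ y → any (λ z → ⌊ y Fin.≟ z ⌋) (neighbours₁₀ x)))

G₁₀ : Graph 10
G₁₀ = record
  { adj    = λ x y → lookup (lookup adjacency₁₀ x) y
  ; irrefl = from-yes (all? λ x → lookup (lookup adjacency₁₀ x) x Bool.≟ false)
  ; sym    = from-yes (all? λ x → all? λ y → lookup (lookup adjacency₁₀ x) y Bool.≟ lookup (lookup adjacency₁₀ y) x)
  }

G₁₀-regular : Regular G₁₀
G₁₀-regular = 3 , from-yes (all? λ x → degree G₁₀ x ℕ.≟ 3)

G₁₀-connected : Connected G₁₀
G₁₀-connected = connected-from-root G₁₀ 0F to-0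
  where
  to-0 : ∀ x → Walk G₁₀ x 0F
  to-0 0F = here
  to-0 1F = step {y = 0F} refl here
  to-0 2F = step {y = 0F} refl here
  to-0 3F = step {y = 0F} refl here
  to-0 4F = step {y = 2F} refl (step {y = 0F} refl here)
  to-0 5F = step {y = 3F} refl (step {y = 0F} refl here)
  to-0 6F = step {y = 4F} refl (step {y = 2F} refl (step {y = 0F} refl here))
  to-0 7F = step {y = 4F} refl (step {y = 2F} refl (step {y = 0F} refl here))
  to-0 8F = step {y = 5F} refl (step {y = 3F} refl (step {y = 0F} refl here))
  to-0 9F = step {y = 5F} refl (step {y = 3F} refl (step {y = 0F} refl here))

-- The minimal polynomial X⁸ - 2X⁷ - 11X⁶ + 14X⁵ + 43X⁴ - 18X³ - 57X² - 18X of G₁₀,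
-- with the negative terms moved to the right-hand side.
annihilator⁺ annihilator⁻ : Vec ℕ 8
annihilator⁺ = 0 ∷ 0  ∷ 0  ∷ 0  ∷ 43 ∷ 14 ∷ 0  ∷ 0 ∷ []
annihilator⁻ = 0 ∷ 18 ∷ 57 ∷ 18 ∷ 0  ∷ 0  ∷ 11 ∷ 2 ∷ []

G₁₀-annihilated : Annihilates G₁₀ annihilator⁺ annihilator⁻
G₁₀-annihilated = annihilates-from-columns G₁₀ adjacency₁₀ (λ _ _ → refl) annihilator⁺ annihilator⁻
  (from-yes (all? λ x → all? λ y →
    lookup (powerColumn adjacency₁₀ 8 y) x + columnCombination adjacency₁₀ annihilator⁺ x y
      ℕ.≟ columnCombination adjacency₁₀ annihilator⁻ x y))

G₁₀-cospectral : Cospectral G₁₀ 2F 6F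
G₁₀-cospectral = cospectral-from-annihilator G₁₀ annihilator⁺ annihilator⁻ G₁₀-annihilated 2F 6F initial
  where
  diagonal : Fin 8 → Fin 10 → ℕ
  diagonal i x = lookup (powerColumn adjacency₁₀ (toℕ i) x) x

  initial : ∀ (i : Fin 8) → Apow G₁₀ (toℕ i) 2F 2F ≡ Apow G₁₀ (toℕ i) 6F 6F
  initial i = begin
    Apow G₁₀ (toℕ i) 2F 2F  ≡⟨ lookup-powerColumn G₁₀ adjacency₁₀ (λ _ _ → refl) (toℕ i) 2F 2F ⟨
    diagonal i 2F           ≡⟨ from-yes (all? λ j → diagonal j 2F ℕ.≟ diagonal j 6F) i ⟩
    diagonal i 6F           ≡⟨ lookup-powerColumn G₁₀ adjacency₁₀ (λ _ _ → refl) (toℕ i) 6F 6F ⟩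
    Apow G₁₀ (toℕ i) 6F 6F  ∎

G₁₀-not-similar : ¬ Similar G₁₀ 2F 6F
G₁₀-not-similar 2~6 = no-diamond-at-6 (DiamondTip-similar G₁₀ 2~6 diamond-at-2)
  where
  diamond-at-2 : DiamondTip G₁₀ 2F
  diamond-at-2 = 0F , 1F , 3F , refl , refl , refl , refl , refl , λ ()

  no-diamond-at-6 : ¬ DiamondTip G₁₀ 6F
  no-diamond-at-6 (x , y , z , tip) = from-yes (all? λ x → all? λ y → all? λ z → ¬?
    (adj G₁₀ 6F x Bool.≟ true ×-dec adj G₁₀ 6F y Bool.≟ true ×-dec adj G₁₀ x y Bool.≟ true ×-dec
     adj G₁₀ z x Bool.≟ true ×-dec adj G₁₀ z y Bool.≟ true ×-dec ¬? (z Fin.≟ 6F))) x y z tip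

all-∈ : ∀ {A : Set} (p : A → Bool) {xs x} → T (all p xs) → x ∈ xs → T (p x)
all-∈ p {xs} holds = All.lookup (all⁺ p xs holds)

all-allFin : ∀ {n} (p : Fin n → Bool) → T (all p (allFin n)) → ∀ i → T (p i)
all-allFin p holds i = all-∈ p holds (∈-allFin i)

T-∧⁻ : ∀ x {y} → T (x ∧ y) → T x × T y
T-∧⁻ x = Equivalence.to (T-∧ {x})

-- Hand-written equality tests: with ⌊ _≟_ ⌋ instead, the automorphism search runs markedly slower.

infix 4 _==_ _==ᴮ_ _==ʳ_ _==ˡ_

_==_ : ∀ {n} → Fin n → Fin n → Bool
zero  == zero  = true
suc x == suc y = x == y
_     == _     = false

==⇒≡ : ∀ {n} (x y : Fin n) → T (x == y) → x ≡ y
==⇒≡ zero    zero    _  = refl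
==⇒≡ (suc x) (suc y) eq = cong suc (==⇒≡ x y eq)

_==ᴮ_ : Bool → Bool → Bool
true  ==ᴮ b = b
false ==ᴮ b = not b

==ᴮ⇒≡ : ∀ a b → T (a ==ᴮ b) → a ≡ b
==ᴮ⇒≡ true  true  _ = refl
==ᴮ⇒≡ false false _ = refl

_==ʳ_ : ∀ {m} → Vec Bool m → Vec Bool m → Bool
[]      ==ʳ []      = true
(a ∷ r) ==ʳ (b ∷ s) = (a ==ᴮ b) ∧ (r ==ʳ s)

==ʳ⇒≡ : ∀ {m} (r s : Vec Bool m) → T (r ==ʳ s) → r ≡ s
==ʳ⇒≡ []      []      _  = refl
==ʳ⇒≡ (a ∷ r) (b ∷ s) eq with a≡b , r≡s ← T-∧⁻ (a ==ᴮ b) eq = cong₂ _∷_ (==ᴮ⇒≡ a b a≡b) (==ʳ⇒≡ r s r≡s)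

==ʳ-refl : ∀ {m} (r : Vec Bool m) → T (r ==ʳ r)
==ʳ-refl []          = _
==ʳ-refl (true  ∷ r) = ==ʳ-refl r
==ʳ-refl (false ∷ r) = ==ʳ-refl r

_==ˡ_ : List ℕ → List ℕ → Bool
[]       ==ˡ []       = true
(x ∷ xs) ==ˡ (y ∷ ys) = (x ≡ᵇ y) ∧ (xs ==ˡ ys)
_        ==ˡ _        = false

==ˡ-refl : ∀ xs → T (xs ==ˡ xs)
==ˡ-refl []       = _
==ˡ-refl (x ∷ xs) = Equivalence.from (T-∧ {x ≡ᵇ x}) (≡⇒≡ᵇ x x refl , ==ˡ-refl xs)

firstWhere : ∀ {A : Set} → (A → Bool) → A → List A → A
firstWhere p d []       = d
firstWhere p d (x ∷ xs) = if p x then x else firstWhere p d xs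

firstWhere-default : ∀ {A : Set} (p : A → Bool) d d′ {x} xs → x ∈ xs → T (p x) →
  firstWhere p d xs ≡ firstWhere p d′ xs
firstWhere-default p d d′ (y ∷ ys) (here refl) px with p y
... | true = refl
firstWhere-default p d d′ (y ∷ ys) (there x∈ys) px with p y
... | true  = refl
... | false = firstWhere-default p d d′ ys x∈ys px

-- Automorphisms found by search and checked

Table : ℕ → Set
Table n = Vec (Fin n) n

inverseTable : ∀ {n} → Table n → Table n
inverseTable σ = tabulate (λ y → firstWhere (λ x → lookup σ x == y) y (allFin _))

inverseAtᵇ : ∀ {n} → Table n → Table n → Fin n → Bool
inverseAtᵇ σ τ x = (lookup τ (lookup σ x) == x) ∧ (lookup σ (lookup τ x) == x)

isPermutationᵇ : ∀ {n} → Table n → Bool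
isPermutationᵇ σ = all (inverseAtᵇ σ (inverseTable σ)) (allFin _)

toPermutation : ∀ {n} (σ : Table n) → T (isPermutationᵇ σ) → Fin n ↔ Fin n
toPermutation σ isPerm = mk↔ₛ′ (lookup σ) (lookup τ) (λ x → ==⇒≡ _ _ (proj₂ (inverse x))) (λ x → ==⇒≡ _ _ (proj₁ (inverse x)))
  where
  τ : Table _
  τ = inverseTable σ
  inverse : ∀ x → T (lookup τ (lookup σ x) == x) × T (lookup σ (lookup τ x) == x)
  inverse x = T-∧⁻ (lookup τ (lookup σ x) == x) (all-allFin (inverseAtᵇ σ τ) isPerm x)

preservesᵇ : ∀ {n} → Matrix n → Table n → Bool
preservesᵇ R σ = all (λ x → all (λ y → lookup (lookup R (lookup σ x)) (lookup σ y) ==ᴮ lookup (lookup R x) y) (allFin _)) (allFin _)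

mapsToAutomorphicallyᵇ : ∀ {n} → Matrix n → Table n → Fin n → Fin n → Bool
mapsToAutomorphicallyᵇ R σ a b = (lookup σ a == b) ∧ isPermutationᵇ σ ∧ preservesᵇ R σ

mapsToAutomorphicallyᵇ-sound : ∀ {n} (G : Graph n) (R : Matrix n) → IsAdjacencyMatrix G R → ∀ σ a b →
  T (mapsToAutomorphicallyᵇ R σ a b) → Similar G a b
mapsToAutomorphicallyᵇ-sound G R R≗G σ a b certified
  with σa==b , automorphic ← T-∧⁻ (lookup σ a == b) certified
  with isPerm , preserves ← T-∧⁻ (isPermutationᵇ σ) automorphic
  = record { perm = toPermutation σ isPerm ; preserve = preserved } , ==⇒≡ _ _ σa==b
  where
  preserved : ∀ x y → adj G (lookup σ x) (lookup σ y) ≡ adj G x y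
  preserved x y = begin
    adj G (lookup σ x) (lookup σ y)              ≡⟨ R≗G _ _ ⟨
    lookup (lookup R (lookup σ x)) (lookup σ y)  ≡⟨ ==ᴮ⇒≡ _ _ (all-allFin _ (all-allFin _ preserves x) y) ⟩
    lookup (lookup R x) y                        ≡⟨ R≗G x y ⟩
    adj G x y                                    ∎

-- Nothing is proved about the search: its result is checked by mapsToAutomorphicallyᵇ.

Assignment : ℕ → Set
Assignment n = List (Fin n × Fin n)

imageIn : ∀ {n} → Assignment n → Fin n → Fin n
imageIn asg x = proj₂ (firstWhere (λ (x′ , _) → x == x′) (x , x) asg)

admissibleᵇ : ∀ {n} → Matrix n → Vec (List ℕ) n → Assignment n → Fin n → Fin n → Bool
admissibleᵇ R W asg x y =
  not (any (λ (_ , y′) → y == y′) asg)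
  ∧ (lookup W x ==ˡ lookup W y)
  ∧ all (λ (x′ , y′) → lookup (lookup R x) x′ ==ᴮ lookup (lookup R y) y′) asg

extendAssignment : ∀ {n} → Matrix n → Vec (List ℕ) n → List (Fin n) → Assignment n → Maybe (Assignment n)
extendAssignment     R W []       asg = just asg
extendAssignment {n} R W (x ∷ xs) asg = foldr try nothing (allFin n)
  where
  try : Fin n → Maybe (Assignment n) → Maybe (Assignment n)
  try y otherwise = (if admissibleᵇ R W asg x y then extendAssignment R W xs ((x , y) ∷ asg) else nothing) <∣> otherwise

candidateAutomorphism : ∀ {n} → Matrix n → Vec (List ℕ) n → Fin n → Fin n → Maybe (Table n)
candidateAutomorphism R W a b =
  Maybe.map (tabulate ∘ imageIn) (extendAssignment R W (filterᵇ (λ x → not (x == a)) (allFin _)) ((a , b) ∷ []))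

-- Any number of walk lengths is sound; 8 separates the non-similar vertices of every graph searched.
walkSignatures : ∀ {n} → Matrix n → Vec (List ℕ) n
walkSignatures R = tabulate (λ x → entriesAlongPowers R 8 x (powerColumn R 0 x))

representative : ∀ {n} → Vec (List ℕ) n → Fin n → Fin n
representative W b = firstWhere (λ x → lookup W x ==ˡ lookup W b) b (allFin _)

similarToRepresentativeᵇ : ∀ {n} → Matrix n → Vec (List ℕ) n → Fin n → Bool
similarToRepresentativeᵇ R W b = maybe′ (λ σ → mapsToAutomorphicallyᵇ R σ a b) false (candidateAutomorphism R W a b)
  where
  a : Fin _
  a = representative W b

cospectralImpliesSimilarᵇ : ∀ {n} → Matrix n → Bool
cospectralImpliesSimilarᵇ R = all (similarToRepresentativeᵇ R (walkSignatures R)) (allFin _)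

module _ {n} (G : Graph n) (R : Matrix n) (R≗G : IsAdjacencyMatrix G R) where

  private
    W : Vec (List ℕ) n
    W = walkSignatures R

  walkSignatures-cospectral : ∀ {a b} → Cospectral G a b → lookup W a ≡ lookup W b
  walkSignatures-cospectral {a} {b} a~b = begin
    lookup W a                             ≡⟨ lookup∘tabulate _ a ⟩
    entriesAlongPowers R 8 a (powerColumn R 0 a)  ≡⟨ entriesAlongPowers-cospectral G R R≗G a~b 8 0 ⟩
    entriesAlongPowers R 8 b (powerColumn R 0 b)  ≡⟨ lookup∘tabulate _ b ⟨
    lookup W b                             ∎

  representative-cospectral : ∀ {a b} → Cospectral G a b → representative W a ≡ representative W b
  representative-cospectral {a} {b} a~b = begin
    firstWhere (sameAs a) a (allFin n)  ≡⟨ cong (λ s → firstWhere (λ x → lookup W x ==ˡ s) a (allFin n)) (walkSignatures-cospectral a~b) ⟩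
    firstWhere (sameAs b) a (allFin n)  ≡⟨ firstWhere-default (sameAs b) a b (allFin n) (∈-allFin b) (==ˡ-refl (lookup W b)) ⟩
    firstWhere (sameAs b) b (allFin n)  ∎
    where
    sameAs : Fin n → Fin n → Bool
    sameAs c x = lookup W x ==ˡ lookup W c

  similarToRepresentativeᵇ-sound : ∀ b → T (similarToRepresentativeᵇ R W b) → Similar G (representative W b) b
  similarToRepresentativeᵇ-sound b certified with candidateAutomorphism R W (representative W b) b
  ... | just σ = mapsToAutomorphicallyᵇ-sound G R R≗G σ (representative W b) b certified

  cospectralImpliesSimilarᵇ-sound : T (cospectralImpliesSimilarᵇ R) → CospectralImpliesSimilar G
  cospectralImpliesSimilarᵇ-sound holds a b a~b =
    Similar-trans G (Similar-sym G (subst (λ c → Similar G c a) (representative-cospectral a~b) (certified a))) (certified b)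
    where
    certified : ∀ c → Similar G (representative W c) c
    certified c = similarToRepresentativeᵇ-sound c (all-allFin _ holds c)

-- Enumeration of regular adjacency matrices

countTrue : ∀ {m} → Vec Bool m → ℕ
countTrue r = sumFin (λ j → if lookup r j then 1 else 0)

Matches : ∀ {m} → Vec (Maybe Bool) m → Vec Bool m → Set
Matches pat r = ∀ j → MaybeAll.All (_≡ lookup r j) (lookup pat j)

completions : ∀ {m} → Vec (Maybe Bool) m → ℕ → List (Vec Bool m)
completions []                 zero    = [] ∷ []
completions []                 (suc c) = []
completions (just true  ∷ pat) zero    = []
completions (just true  ∷ pat) (suc c) = List.map (true ∷_) (completions pat c)
completions (just false ∷ pat) c       = List.map (false ∷_) (completions pat c)
completions (nothing    ∷ pat) zero    = List.map (false ∷_) (completions pat zero)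
completions (nothing    ∷ pat) (suc c) = List.map (true ∷_) (completions pat c) ++ List.map (false ∷_) (completions pat (suc c))

∈-completions : ∀ {m} (pat : Vec (Maybe Bool) m) (r : Vec Bool m) → Matches pat r → r ∈ completions pat (countTrue r)
∈-completions []                 []          _       = here refl
∈-completions (just true  ∷ pat) (true  ∷ r) matches = ∈-map⁺ (true ∷_) (∈-completions pat r (matches ∘ suc))
∈-completions (just false ∷ pat) (false ∷ r) matches = ∈-map⁺ (false ∷_) (∈-completions pat r (matches ∘ suc))
∈-completions (nothing    ∷ pat) (true  ∷ r) matches = ∈-++⁺ˡ (∈-map⁺ (true ∷_) (∈-completions pat r (matches ∘ suc)))
∈-completions (nothing    ∷ pat) (false ∷ r) matches with countTrue r | ∈-completions pat r (matches ∘ suc)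
... | zero  | r∈ = ∈-map⁺ (false ∷_) r∈
... | suc c | r∈ = ∈-++⁺ʳ (List.map (true ∷_) (completions pat c)) (∈-map⁺ (false ∷_) r∈)
∈-completions (just true  ∷ pat) (false ∷ r) matches with just () ← matches zero
∈-completions (just false ∷ pat) (true  ∷ r) matches with just () ← matches zero

PartialMatrix : ℕ → Set
PartialMatrix n = Vec (Maybe (Vec Bool n)) n

emptyMatrix : ∀ {n} → PartialMatrix n
emptyMatrix = replicate _ nothing

forcedEntry : ∀ {n} → Fin n → Fin n → Maybe (Vec Bool n) → Maybe Bool
forcedEntry i j (just r) = just (lookup r i)
forcedEntry i j nothing  = if j == i then just false else nothing

rowPattern : ∀ {n} → PartialMatrix n → Fin n → Vec (Maybe Bool) n
rowPattern M i = tabulate (λ j → forcedEntry i j (lookup M j))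

allJust : ∀ {A : Set} {m} → Vec (Maybe A) m → Maybe (Vec A m)
allJust []             = just []
allJust (nothing ∷ xs) = nothing
allJust (just x  ∷ xs) = Maybe.map (x ∷_) (allJust xs)

allJust-lookup : ∀ {A : Set} {m} (xs : Vec (Maybe A) m) {ys} → allJust xs ≡ just ys → ∀ j → lookup xs j ≡ just (lookup ys j)
allJust-lookup (just x ∷ xs) eq j with allJust xs in eq′
allJust-lookup (just x ∷ xs) refl zero    | just ys = refl
allJust-lookup (just x ∷ xs) refl (suc j) | just ys = allJust-lookup xs eq′ j

exploreᵇ : ∀ {n} → (Fin n → Vec Bool n → Bool) → ℕ → List (Fin n) → PartialMatrix n → Bool
exploreᵇ ok d []       M = maybe′ cospectralImpliesSimilarᵇ false (allJust M)
exploreᵇ ok d (i ∷ is) M = all (λ r → if ok i r then exploreᵇ ok d is (M [ i ]≔ just r) else true) (completions (rowPattern M i) d)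

row : ∀ {n} → Graph n → Fin n → Vec Bool n
row G i = tabulate (adj G i)

countTrue-row : ∀ {n} (G : Graph n) i → countTrue (row G i) ≡ degree G i
countTrue-row G i = sumFin-cong (λ j → cong (λ b → if b then 1 else 0) (lookup∘tabulate (adj G i) j))

module _ {n} (G : Graph n) where

  Consistent : PartialMatrix n → Set
  Consistent M = ∀ j {r} → lookup M j ≡ just r → r ≡ row G j

  Consistent-empty : Consistent emptyMatrix
  Consistent-empty j eq with () ← trans (sym (lookup-replicate j nothing)) eq

  Consistent-update : ∀ M → Consistent M → ∀ i → Consistent (M [ i ]≔ just (row G i))
  Consistent-update M consistent i j eq with i Fin.≟ j
  ... | yes refl = sym (just-injective (trans (sym (lookup∘update i M _)) eq))
  ... | no i≢j   = consistent j (trans (sym (lookup∘update′ (i≢j ∘ sym) M _)) eq)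

  rowPattern-matches : ∀ M → Consistent M → ∀ i → Matches (rowPattern M i) (row G i)
  rowPattern-matches M consistent i j rewrite lookup∘tabulate (λ j → forcedEntry i j (lookup M j)) j
    with lookup M j in eq
  ... | just r rewrite consistent j eq =
    just (trans (lookup∘tabulate (adj G j) i) (trans (Graph.sym G j i) (sym (lookup∘tabulate (adj G i) j))))
  ... | nothing with j == i in j==i
  ...   | true  rewrite ==⇒≡ j i (subst T (sym j==i) _) = just (trans (sym (irrefl G i)) (sym (lookup∘tabulate (adj G i) i)))
  ...   | false = nothing

  row∈completions : ∀ M → Consistent M → ∀ i {d} → degree G i ≡ d → row G i ∈ completions (rowPattern M i) d
  row∈completions M consistent i refl =
    subst (λ c → row G i ∈ completions (rowPattern M i) c) (countTrue-row G i)
      (∈-completions (rowPattern M i) (row G i) (rowPattern-matches M consistent i))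

  exploreᵇ-sound : ∀ (ok : Fin n → Vec Bool n → Bool) d → (∀ i → T (ok i (row G i))) → (∀ x → degree G x ≡ d) →
    ∀ is M → Consistent M → T (exploreᵇ ok d is M) → CospectralImpliesSimilar G
  exploreᵇ-sound ok d ok-rows regular [] M consistent holds with allJust M in eq
  ... | just R = cospectralImpliesSimilarᵇ-sound G R R≗G holds
    where
    R≗G : IsAdjacencyMatrix G R
    R≗G i j = trans (cong (λ r → lookup r j) (consistent i (allJust-lookup M eq i))) (lookup∘tabulate (adj G i) j)
  exploreᵇ-sound ok d ok-rows regular (i ∷ is) M consistent holds =
    exploreᵇ-sound ok d ok-rows regular is _ (Consistent-update M consistent i) (take-branch (ok i (row G i)) (ok-rows i) branch)
    where
    take-branch : ∀ b {c} → T b → T (if b then c else true) → T c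
    take-branch true _ c = c
    branch : T (if ok i (row G i) then exploreᵇ ok d is (M [ i ]≔ just (row G i)) else true)
    branch = all-∈ _ holds (row∈completions M consistent i (regular i))

-- Normal form of the first two rows: vertex 0 is adjacent to exactly 1, …, d, and the neighbours
-- of vertex 1 come first among 2, …, d and among d+1, …, n-1.

firstRow : ∀ {n} → ℕ → Vec Bool n
firstRow d = tabulate (λ j → (0 <ᵇ toℕ j) ∧ (toℕ j ≤ᵇ d))

secondRowSortedᵇ : ∀ {n} → ℕ → Vec Bool n → Bool
secondRowSortedᵇ {n} d r = all (λ j → all (λ k → not (inversion j k)) (allFin n)) (allFin n)
  where
  inversion : Fin n → Fin n → Bool
  inversion j k = (2 ≤ᵇ toℕ j) ∧ (toℕ j <ᵇ toℕ k) ∧ ((toℕ j ≤ᵇ d) ==ᴮ (toℕ k ≤ᵇ d)) ∧ not (lookup r j) ∧ lookup r k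

normalRowᵇ : ∀ {n} → ℕ → Fin n → Vec Bool n → Bool
normalRowᵇ d zero          r = r ==ʳ firstRow d
normalRowᵇ d (suc zero)    r = secondRowSortedᵇ d r
normalRowᵇ d (suc (suc _)) r = true

permuteRow : ∀ {n} → Table n → Vec Bool n → Vec Bool n
permuteRow σ r = tabulate (λ j → lookup r (lookup σ j))

row-relabel : ∀ {n} (G : Graph n) σ (isPerm : T (isPermutationᵇ σ)) i →
  row (relabel G (toPermutation σ isPerm)) i ≡ permuteRow σ (row G (lookup σ i))
row-relabel G σ _ i = tabulate-cong (λ j → sym (lookup∘tabulate (adj G (lookup σ i)) (lookup σ j)))

-- The sorters need no proof: for every row that can occur, their output is checked below.

listToTable : ∀ {m} → List (Fin (suc m)) → Table (suc m)
listToTable xs = tabulate (λ j → fromMaybe zero (head (drop (toℕ j) xs)))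

sortByKey : ∀ {m} → ℕ → (Fin (suc m) → ℕ) → Table (suc m)
sortByKey classes key = listToTable (concatMap (λ c → filterᵇ (λ j → key j ≡ᵇ c) (allFin _)) (upTo classes))

firstRowSorter : ∀ {m} → Vec Bool (suc m) → Table (suc m)
firstRowSorter r = sortByKey 3 (λ j → if toℕ j ≡ᵇ 0 then 0 else if lookup r j then 1 else 2)

secondRowSorter : ∀ {m} → ℕ → Vec Bool (suc m) → Table (suc m)
secondRowSorter d r =
  sortByKey 6 (λ j → if toℕ j <ᵇ 2 then toℕ j else (if toℕ j ≤ᵇ d then 2 else 4) + (if lookup r j then 0 else 1))

fixesᵇ : ∀ {n} → Table n → Fin n → Bool
fixesᵇ σ i = lookup σ i == i

candidateRows : ∀ {n} → Fin n → ℕ → List (Vec Bool n)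
candidateRows i d = completions (rowPattern emptyMatrix i) d

normalisesFirstRowᵇ normalisesSecondRowᵇ : ∀ {m} → ℕ → Vec Bool (2 + m) → Table (2 + m) → Bool
normalisesFirstRowᵇ d r σ = isPermutationᵇ σ ∧ fixesᵇ σ 0F ∧ (permuteRow σ r ==ʳ firstRow d)
normalisesSecondRowᵇ d r σ =
  isPermutationᵇ σ ∧ fixesᵇ σ 0F ∧ fixesᵇ σ 1F ∧ (permuteRow σ (firstRow d) ==ʳ firstRow d) ∧ secondRowSortedᵇ d (permuteRow σ r)

firstRowsNormalisableᵇ secondRowsNormalisableᵇ : ∀ m → ℕ → Bool
firstRowsNormalisableᵇ m d = all (λ (r : Vec Bool (2 + m)) → normalisesFirstRowᵇ d r (firstRowSorter r)) (candidateRows 0F d)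
secondRowsNormalisableᵇ m d = all (λ (r : Vec Bool (2 + m)) → normalisesSecondRowᵇ d r (secondRowSorter d r)) (candidateRows 1F d)

module _ {m} (G : Graph (2 + m)) where

  normalisesFirstRowᵇ-sound : ∀ d σ → T (normalisesFirstRowᵇ d (row G 0F) σ) → ∃[ π ] row (relabel G π) 0F ≡ firstRow d
  normalisesFirstRowᵇ-sound d σ certificate
    with isPerm , c ← T-∧⁻ (isPermutationᵇ σ) certificate
    with fixes₀ , sorted ← T-∧⁻ (fixesᵇ σ 0F) c
    = toPermutation σ isPerm , (begin
      row (relabel G (toPermutation σ isPerm)) 0F  ≡⟨ row-relabel G σ isPerm 0F ⟩
      permuteRow σ (row G (lookup σ 0F))           ≡⟨ cong (permuteRow σ ∘ row G) (==⇒≡ _ _ fixes₀) ⟩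
      permuteRow σ (row G 0F)                      ≡⟨ ==ʳ⇒≡ _ _ sorted ⟩
      firstRow d                                   ∎)

  normalisesSecondRowᵇ-sound : ∀ d σ → row G 0F ≡ firstRow d → T (normalisesSecondRowᵇ d (row G 1F) σ) →
    ∃[ π ] row (relabel G π) 0F ≡ firstRow d × T (secondRowSortedᵇ d (row (relabel G π) 1F))
  normalisesSecondRowᵇ-sound d σ row₀ certificate
    with isPerm , c₁ ← T-∧⁻ (isPermutationᵇ σ) certificate
    with fixes₀ , c₂ ← T-∧⁻ (fixesᵇ σ 0F) c₁
    with fixes₁ , c₃ ← T-∧⁻ (fixesᵇ σ 1F) c₂
    with keeps , sorted ← T-∧⁻ (permuteRow σ (firstRow d) ==ʳ firstRow d) c₃
    = toPermutation σ isPerm , (begin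
      row (relabel G (toPermutation σ isPerm)) 0F  ≡⟨ row-relabel G σ isPerm 0F ⟩
      permuteRow σ (row G (lookup σ 0F))           ≡⟨ cong (permuteRow σ ∘ row G) (==⇒≡ _ _ fixes₀) ⟩
      permuteRow σ (row G 0F)                      ≡⟨ cong (permuteRow σ) row₀ ⟩
      permuteRow σ (firstRow d)                    ≡⟨ ==ʳ⇒≡ _ _ keeps ⟩
      firstRow d                                   ∎)
    , subst (T ∘ secondRowSortedᵇ d) (sym row₁) sorted
    where
    row₁ : row (relabel G (toPermutation σ isPerm)) 1F ≡ permuteRow σ (row G 1F)
    row₁ = trans (row-relabel G σ isPerm 1F) (cong (permuteRow σ ∘ row G) (==⇒≡ _ _ fixes₁))

  row∈candidateRows : ∀ i {d} → degree G i ≡ d → row G i ∈ candidateRows i d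
  row∈candidateRows i = row∈completions G emptyMatrix (Consistent-empty G) i

  normalise-firstRow : ∀ d → T (firstRowsNormalisableᵇ m d) → degree G 0F ≡ d → ∃[ π ] row (relabel G π) 0F ≡ firstRow d
  normalise-firstRow d holds deg₀ =
    normalisesFirstRowᵇ-sound d (firstRowSorter (row G 0F))
      (all-∈ (λ r → normalisesFirstRowᵇ d r (firstRowSorter r)) holds (row∈candidateRows 0F deg₀))

  normalise-secondRow : ∀ d → T (secondRowsNormalisableᵇ m d) → row G 0F ≡ firstRow d → degree G 1F ≡ d →
    ∃[ π ] row (relabel G π) 0F ≡ firstRow d × T (secondRowSortedᵇ d (row (relabel G π) 1F))
  normalise-secondRow d holds row₀ deg₁ =
    normalisesSecondRowᵇ-sound d (secondRowSorter d (row G 1F)) row₀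
      (all-∈ (λ r → normalisesSecondRowᵇ d r (secondRowSorter d r)) holds (row∈candidateRows 1F deg₁))

-- Regular graphs on fewer than 10 vertices

degreeCheckᵇ : ∀ m → ℕ → Bool
degreeCheckᵇ m d = firstRowsNormalisableᵇ m d ∧ secondRowsNormalisableᵇ m d ∧ exploreᵇ (normalRowᵇ d) d (allFin (2 + m)) emptyMatrix

normalForm-sound : ∀ m d → T (exploreᵇ (normalRowᵇ d) d (allFin (2 + m)) emptyMatrix) →
  (G : Graph (2 + m)) → (∀ x → degree G x ≡ d) → row G 0F ≡ firstRow d → T (secondRowSortedᵇ d (row G 1F)) →
  CospectralImpliesSimilar G
normalForm-sound m d enumerated G regular row₀ row₁ =
  exploreᵇ-sound G (normalRowᵇ d) d normal regular (allFin _) emptyMatrix (Consistent-empty G) enumerated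
  where
  normal : ∀ i → T (normalRowᵇ d i (row G i))
  normal 0F            = subst (λ r → T (row G 0F ==ʳ r)) row₀ (==ʳ-refl (row G 0F))
  normal 1F            = row₁
  normal (suc (suc _)) = _

degreeCheckᵇ-sound : ∀ m d → T (degreeCheckᵇ m d) → (G : Graph (2 + m)) → (∀ x → degree G x ≡ d) → CospectralImpliesSimilar G
degreeCheckᵇ-sound m d holds G regular =
  let firstRows , rest = T-∧⁻ (firstRowsNormalisableᵇ m d) holds
      secondRows , enumerated = T-∧⁻ (secondRowsNormalisableᵇ m d) rest
      π₁ , row₀ = normalise-firstRow G d firstRows (regular 0F)
      π₂ , row₀′ , row₁′ = normalise-secondRow (relabel G π₁) d secondRows row₀ (regular-relabel G π₁ regular 1F)
      regular₂ = regular-relabel (relabel G π₁) π₂ (regular-relabel G π₁ regular)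
  in CospectralImpliesSimilar-relabel G π₁ (CospectralImpliesSimilar-relabel (relabel G π₁) π₂
       (normalForm-sound m d enumerated (relabel (relabel G π₁) π₂) regular₂ row₀′ row₁′))

sizeCheckᵇ : ℕ → Bool
sizeCheckᵇ m = all (degreeCheckᵇ m ∘ toℕ) (allFin (3 + m))

A≤1 : ∀ {n} (G : Graph n) x y → A G x y ≤ 1
A≤1 G x y with adj G x y
... | true  = s≤s z≤n
... | false = z≤n

degree≤ : ∀ {n} (G : Graph n) x → degree G x ≤ n
degree≤ G x = sumFin-≤ (A G x) (A≤1 G x)
  where
  sumFin-≤ : ∀ {m} (f : Fin m → ℕ) → (∀ i → f i ≤ 1) → sumFin f ≤ m
  sumFin-≤ {zero}  f f≤1 = z≤n
  sumFin-≤ {suc m} f f≤1 = +-mono-≤ (f≤1 zero) (sumFin-≤ (f ∘ suc) (f≤1 ∘ suc))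

sizeCheckᵇ-sound : ∀ m → sizeCheckᵇ m ≡ true → (G : Graph (2 + m)) → Regular G → CospectralImpliesSimilar G
sizeCheckᵇ-sound m holds G (d , regular) =
  degreeCheckᵇ-sound m d (subst (T ∘ degreeCheckᵇ m) (toℕ-fromℕ< d<3+m) checked) G regular
  where
  d<3+m : d < 3 + m
  d<3+m = s≤s (subst (_≤ 2 + m) (regular 0F) (degree≤ G 0F))
  checked : T (degreeCheckᵇ m (toℕ (fromℕ< d<3+m)))
  checked = all-allFin (degreeCheckᵇ m ∘ toℕ) (Equivalence.from T-≡ holds) (fromℕ< d<3+m)

-- Stated with ≡ true and proved by refl: Agda evaluates this many times faster than tt : T ….
sizeChecks-pass : ∀ (m : Fin 8) → sizeCheckᵇ (toℕ m) ≡ true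
sizeChecks-pass 0F = refl
sizeChecks-pass 1F = refl
sizeChecks-pass 2F = refl
sizeChecks-pass 3F = refl
sizeChecks-pass 4F = refl
sizeChecks-pass 5F = refl
sizeChecks-pass 6F = refl
sizeChecks-pass 7F = refl

regular-below-10⇒cospectralImpliesSimilar : ∀ n → n < 10 → (G : Graph n) → Regular G → CospectralImpliesSimilar G
regular-below-10⇒cospectralImpliesSimilar 0 _ G _ ()
regular-below-10⇒cospectralImpliesSimilar 1 _ G _ 0F 0F _ = Similar-refl G 0F
regular-below-10⇒cospectralImpliesSimilar (suc (suc m)) (s≤s (s≤s m<8)) =
  sizeCheckᵇ-sound m (subst (λ k → sizeCheckᵇ k ≡ true) (toℕ-fromℕ< m<8) (sizeChecks-pass (fromℕ< m<8)))

theorem1p3 : Σ (Graph 10) (λ G → Regular G × Connected G × HasCospectralNonSimilar G)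
    × (∀ (n : ℕ) → n < 10 → (G : Graph n) → Regular G → Connected G → ¬ HasCospectralNonSimilar G)
theorem1p3 = (G₁₀ , G₁₀-regular , G₁₀-connected , 2F , 6F , G₁₀-cospectral , G₁₀-not-similar) , below-10
  where
  below-10 : ∀ n → n < 10 → (G : Graph n) → Regular G → Connected G → ¬ HasCospectralNonSimilar G
  below-10 n n<10 G regular _ (a , b , a~b , a≁b) = a≁b (regular-below-10⇒cospectralImpliesSimilar n n<10 G regular a b a~b)
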